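{- Let $f$ be an $n$-ary polymorphism of $(\mathbf{LO}_2,\mathbf{LO}_3)$. A boolean set $X\subseteq[n]$ of $f$ is static if and only if there exist sets $Y,Z$ such that $(X,Y,Z)$ is a boolean partition of $[n]$.
   Context: $[n]=\{1,\dots,n\}$. $\mathrm{LO}_3\subseteq\{0,1,2\}^3$ is the set of triples whose maximum entry occurs in exactly one coordinate. Identify $X\subseteq[n]$ with the 0/1 tuple having 1 exactly in positions of $X$. $f:\{0,1\}^n\to\{0,1,2\}$ is a polymorphism of $(\mathbf{LO}_2,\mathbf{LO}_3)$ iff for every ordered partition $(X,Y,Z)$ of $[n]$ into three (possibly empty) parts, $(f(X),f(Y),f(Z))\in\mathrm{LO}_3$. $X$ is a boolean set if $f(X)\in\{0,1\}$. A partition $(X,Y,Z)$ is boolean if $\{f(X),f(Y),f(Z)\}=\{0,1\}$. For $i\ne f(X)$, $X$ is $i$-recolourable if changing the value of $f$ at $X$ alone to $i$ still yields a polymorphism. A boolean set $X$ with $f(X)=i\in\{0,1\}$ is static if it is not $(1-i)$-recolourable. -}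

module Defs where

open import Data.Nat using (ℕ; _⊔_)
open import Data.Fin using (Fin; toℕ; zero; suc)
open import Data.Bool using (Bool; true; false; if_then_else_)
open import Data.Vec using (Vec; lookup)
open import Data.Vec.Properties using (≡-dec)
import Data.Bool.Properties as BoolP
open import Data.Product using (_×_; ∃; ∃-syntax; _,_)
open import Data.Sum using (_⊎_)
open import Data.Unit using (⊤)
open import Data.Empty using (⊥)
open import Relation.Nullary using (¬_; Dec; yes; no)
open import Relation.Binary.PropositionalEquality using (_≡_; _≢_)

-- A subset of [n] is identified with its 0/1 tuple (true = 1).
Subset : ℕ → Set
Subset n = Vec Bool n

Three : Set
Three = Fin 3

𝟘 𝟙 : Three
𝟘 = zero
𝟙 = suc zero

max3 : Three → Three → Three → ℕ
max3 a b c = toℕ a ⊔ (toℕ b ⊔ toℕ c)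

LO3 : Three → Three → Three → Set
LO3 a b c =
    (toℕ a ≡ max3 a b c × toℕ b ≢ max3 a b c × toℕ c ≢ max3 a b c)
  ⊎ (toℕ a ≢ max3 a b c × toℕ b ≡ max3 a b c × toℕ c ≢ max3 a b c)
  ⊎ (toℕ a ≢ max3 a b c × toℕ b ≢ max3 a b c × toℕ c ≡ max3 a b c)

ExactlyOne : Bool → Bool → Bool → Set
ExactlyOne true  false false = ⊤
ExactlyOne false true  false = ⊤
ExactlyOne false false true  = ⊤
ExactlyOne _     _     _     = ⊥

IsPartition : {n : ℕ} → Subset n → Subset n → Subset n → Set
IsPartition {n} X Y Z = (i : Fin n) → ExactlyOne (lookup X i) (lookup Y i) (lookup Z i)

IsPolymorphism : {n : ℕ} → (Subset n → Three) → Set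
IsPolymorphism {n} f =
  (X Y Z : Subset n) → IsPartition X Y Z → LO3 (f X) (f Y) (f Z)

IsBoolean : {n : ℕ} → (Subset n → Three) → Subset n → Set
IsBoolean f X = (f X ≡ 𝟘) ⊎ (f X ≡ 𝟙)

IsBooleanPartition : {n : ℕ} → (Subset n → Three) → Subset n → Subset n → Subset n → Set
IsBooleanPartition f X Y Z =
    IsPartition X Y Z
  × IsBoolean f X × IsBoolean f Y × IsBoolean f Z
  × (f X ≡ 𝟘 ⊎ f Y ≡ 𝟘 ⊎ f Z ≡ 𝟘)
  × (f X ≡ 𝟙 ⊎ f Y ≡ 𝟙 ⊎ f Z ≡ 𝟙)

recolour : {n : ℕ} → (Subset n → Three) → Subset n → Three → (Subset n → Three)
recolour f X i W with ≡-dec BoolP._≟_ W X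
... | yes _ = i
... | no  _ = f W

Recolourable : {n : ℕ} → (Subset n → Three) → Subset n → Three → Set
Recolourable f X i = i ≢ f X × IsPolymorphism (recolour f X i)

flipB : Three → Three
flipB zero = 𝟙
flipB _    = 𝟘

IsStatic : {n : ℕ} → (Subset n → Three) → Subset n → Set
IsStatic f X = IsBoolean f X × ¬ Recolourable f X (flipB (f X))

module Submission where

-- Recolouring X only affects the partitions having X as a part. A triple in LO₃ is either
-- boolean (one 1 and two 0s) or contains a unique 2, and moving entries between 0 and 1
-- cannot disturb a unique 2. Hence flipping f(X) keeps f a polymorphism unless X is a part
-- of a boolean partition (X, Y, Z); conversely, in such a partition the flip produces either
-- no 1 at all or a second 1. Since [n] is finite, the existence of a boolean partition is
-- decidable, which turns "not recolourable" into an actual witness.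

open import Defs
open import Data.Nat using (ℕ)
import Data.Nat as ℕ using (_≟_)
open import Data.Fin using (zero; suc; toℕ; _≟_)
open import Data.Fin.Properties using (all?)
open import Data.Fin.Subset.Properties using (anySubset?)
open import Data.Product using (∃-syntax; _×_; _,_)
open import Data.Sum using (_⊎_; inj₁; inj₂)
open import Data.Empty using (⊥-elim)
open import Data.Bool using (true; false)
open import Data.Vec using (lookup)
open import Data.Vec.Properties using (≡-dec)
import Data.Bool.Properties as Bool
open import Function.Bundles using (_⇔_; mk⇔)
open import Relation.Nullary using (¬_; Dec; yes; no)
open import Relation.Nullary.Decidable
  using (_→-dec_; _×-dec_; _⊎-dec_; ¬?; from-yes; decidable-stable)
open import Relation.Binary.PropositionalEquality using (_≡_; _≢_; refl; sym; subst)

IsBooleanValue : Three → Set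
IsBooleanValue a = a ≡ 𝟘 ⊎ a ≡ 𝟙

IsBooleanTriple : Three → Three → Three → Set
IsBooleanTriple a b c =
    IsBooleanValue a × IsBooleanValue b × IsBooleanValue c
  × (a ≡ 𝟘 ⊎ b ≡ 𝟘 ⊎ c ≡ 𝟘)
  × (a ≡ 𝟙 ⊎ b ≡ 𝟙 ⊎ c ≡ 𝟙)

Recoloured : Three → Three → Three → Three → Set
Recoloured i j a a′ = a′ ≡ a ⊎ (a ≡ i × a′ ≡ j)

isBooleanValue? : ∀ a → Dec (IsBooleanValue a)
isBooleanValue? a = (a ≟ 𝟘) ⊎-dec (a ≟ 𝟙)

isBooleanTriple? : ∀ a b c → Dec (IsBooleanTriple a b c)
isBooleanTriple? a b c =
  isBooleanValue? a ×-dec isBooleanValue? b ×-dec isBooleanValue? c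
  ×-dec ((a ≟ 𝟘) ⊎-dec (b ≟ 𝟘) ⊎-dec (c ≟ 𝟘))
  ×-dec ((a ≟ 𝟙) ⊎-dec (b ≟ 𝟙) ⊎-dec (c ≟ 𝟙))

recoloured? : ∀ i j a a′ → Dec (Recoloured i j a a′)
recoloured? i j a a′ = (a′ ≟ a) ⊎-dec ((a ≟ i) ×-dec (a′ ≟ j))

LO3? : ∀ a b c → Dec (LO3 a b c)
LO3? a b c =
      (is a ×-dec ¬? (is b) ×-dec ¬? (is c))
  ⊎-dec (¬? (is a) ×-dec is b ×-dec ¬? (is c))
  ⊎-dec (¬? (is a) ×-dec ¬? (is b) ×-dec is c)
  where is = λ x → toℕ x ℕ.≟ max3 a b c

flipB-≢ : ∀ i → flipB i ≢ i
flipB-≢ zero    ()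
flipB-≢ (suc i) ()

flipB-boolean : ∀ i → IsBooleanValue (flipB i)
flipB-boolean zero    = inj₂ refl
flipB-boolean (suc i) = inj₁ refl

isBooleanTriple-rotate : ∀ a b c → IsBooleanTriple a b c → IsBooleanTriple c a b
isBooleanTriple-rotate = from-yes (all? λ a → all? λ b → all? λ c →
  isBooleanTriple? a b c →-dec isBooleanTriple? c a b)

-- The entries that change are 0 or 1, while a non-boolean triple in LO₃ has a unique 2.
LO3-recoloured : ∀ i j a b c a′ b′ c′ → IsBooleanValue i → IsBooleanValue j →
  LO3 a b c → ¬ IsBooleanTriple a b c →
  Recoloured i j a a′ → Recoloured i j b b′ → Recoloured i j c c′ → LO3 a′ b′ c′
LO3-recoloured = from-yes
  (all? λ i → all? λ j → all? λ a → all? λ b → all? λ c →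
   all? λ a′ → all? λ b′ → all? λ c′ →
   isBooleanValue? i →-dec isBooleanValue? j →-dec
   LO3? a b c →-dec ¬? (isBooleanTriple? a b c) →-dec
   recoloured? i j a a′ →-dec recoloured? i j b b′ →-dec recoloured? i j c c′ →-dec
   LO3? a′ b′ c′)

LO3-flip-head : ∀ i b c b′ c′ → IsBooleanTriple i b c → LO3 i b c →
  Recoloured i (flipB i) b b′ → Recoloured i (flipB i) c c′ → ¬ LO3 (flipB i) b′ c′
LO3-flip-head = from-yes (all? λ i → all? λ b → all? λ c → all? λ b′ → all? λ c′ →
  isBooleanTriple? i b c →-dec LO3? i b c →-dec
  recoloured? i (flipB i) b b′ →-dec recoloured? i (flipB i) c c′ →-dec
  ¬? (LO3? (flipB i) b′ c′))

exactlyOne? : ∀ a b c → Dec (ExactlyOne a b c)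
exactlyOne? true  false false = yes _
exactlyOne? false true  false = yes _
exactlyOne? false false true  = yes _
exactlyOne? true  true  _     = no λ ()
exactlyOne? true  false true  = no λ ()
exactlyOne? false true  true  = no λ ()
exactlyOne? false false false = no λ ()

exactlyOne-rotate : ∀ a b c → ExactlyOne a b c → ExactlyOne c a b
exactlyOne-rotate true  false false _ = _
exactlyOne-rotate false true  false _ = _
exactlyOne-rotate false false true  _ = _
exactlyOne-rotate true  true  _     ()
exactlyOne-rotate true  false true  ()
exactlyOne-rotate false true  true  ()
exactlyOne-rotate false false false ()

module _ {n : ℕ} where

  isPartition? : (X Y Z : Subset n) → Dec (IsPartition X Y Z)
  isPartition? X Y Z = all? λ k → exactlyOne? (lookup X k) (lookup Y k) (lookup Z k)

  isPartition-rotate : (X Y Z : Subset n) → IsPartition X Y Z → IsPartition Z X Y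
  isPartition-rotate X Y Z part k = exactlyOne-rotate _ _ _ (part k)

  booleanPartition? : (f : Subset n → Three) (X : Subset n) →
    Dec (∃[ Y ] ∃[ Z ] IsBooleanPartition f X Y Z)
  booleanPartition? f X = anySubset? λ Y → anySubset? λ Z →
    isPartition? X Y Z ×-dec isBooleanTriple? (f X) (f Y) (f Z)

  module _ (f : Subset n → Three) (X : Subset n) (j : Three) where

    recolour-self : recolour f X j X ≡ j
    recolour-self with ≡-dec Bool._≟_ X X
    ... | yes _  = refl
    ... | no X≢X = ⊥-elim (X≢X refl)

    recolour-other : ∀ {W} → W ≢ X → recolour f X j W ≡ f W
    recolour-other {W} W≢X with ≡-dec Bool._≟_ W X
    ... | yes W≡X = ⊥-elim (W≢X W≡X)
    ... | no  _   = refl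

    recolour-recoloured : ∀ W → Recoloured (f X) j (f W) (recolour f X j W)
    recolour-recoloured W with ≡-dec Bool._≟_ W X
    ... | yes refl = inj₂ (refl , refl)
    ... | no  _    = inj₁ refl

LO3-cong : ∀ {a b c a′ b′ c′} → a ≡ a′ → b ≡ b′ → c ≡ c′ → LO3 a b c → LO3 a′ b′ c′
LO3-cong refl refl refl abc = abc

module _ {n : ℕ} {f : Subset n → Three} (poly : IsPolymorphism f)
         {X : Subset n} (boolX : IsBoolean f X) where

  private
    flipped = flipB (f X)
    g = recolour f X flipped

  booleanPartition⇒static : ∃[ Y ] ∃[ Z ] IsBooleanPartition f X Y Z → IsStatic f X
  booleanPartition⇒static (Y , Z , part , boolean) = boolX , λ (_ , polyg) →
    LO3-flip-head (f X) (f Y) (f Z) (g Y) (g Z) boolean (poly X Y Z part)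
      (recolour-recoloured f X flipped Y) (recolour-recoloured f X flipped Z)
      (subst (λ a → LO3 a (g Y) (g Z)) (recolour-self f X flipped) (polyg X Y Z part))

  noBooleanPartition⇒recolourable : ¬ (∃[ Y ] ∃[ Z ] IsBooleanPartition f X Y Z) →
    Recolourable f X flipped
  noBooleanPartition⇒recolourable none = flipB-≢ (f X) , polyg
    where
    polyg : IsPolymorphism g
    polyg A B C part with isBooleanTriple? (f A) (f B) (f C)
    ... | no nonBoolean =
      LO3-recoloured (f X) flipped (f A) (f B) (f C) (g A) (g B) (g C)
        boolX (flipB-boolean (f X)) (poly A B C part) nonBoolean
        (recolour-recoloured f X flipped A) (recolour-recoloured f X flipped B)
        (recolour-recoloured f X flipped C)
    ... | yes boolean =
      LO3-cong (sym (recolour-other f X flipped A≢X)) (sym (recolour-other f X flipped B≢X))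
        (sym (recolour-other f X flipped C≢X)) (poly A B C part)
      where
      A≢X : A ≢ X
      A≢X refl = none (B , C , part , boolean)
      B≢X : B ≢ X
      B≢X refl = none (C , A , isPartition-rotate C A X (isPartition-rotate A X C part) ,
        isBooleanTriple-rotate _ _ _ (isBooleanTriple-rotate _ _ _ boolean))
      C≢X : C ≢ X
      C≢X refl = none (A , B , isPartition-rotate A B X part ,
        isBooleanTriple-rotate _ _ _ boolean)

  static⇒booleanPartition : IsStatic f X → ∃[ Y ] ∃[ Z ] IsBooleanPartition f X Y Z
  static⇒booleanPartition (_ , notRecolourable) =
    decidable-stable (booleanPartition? f X) (λ none →
      notRecolourable (noBooleanPartition⇒recolourable none))

mainTheorem4 : (n : ℕ) (f : Subset n → Three) → IsPolymorphism f →
    (X : Subset n) → IsBoolean f X →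
    (IsStatic f X ⇔ (∃[ Y ] ∃[ Z ] IsBooleanPartition f X Y Z))
mainTheorem4 n f poly X boolX =
  mk⇔ (static⇒booleanPartition poly boolX) (booleanPartition⇒static poly boolX)
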